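{- Work over $\mathbb{Z}[a,q]$. For $0\leq i\leq n$ let $g_i(x)=\sum_{k=0}^iA_{ik}a^kx^k$ with $A_{ik}\in\mathbb{Z}[a,q]$ and $A_{ii}=1$. Then the matrix $(g_i([j]_q))_{0\leq i,j\leq n}$ has special Smith normal form $\mathrm{diag}\big(1,a^1q^{\binom12}[1]!_q,a^2q^{\binom22}[2]!_q,\ldots,a^nq^{\binom n2}[n]!_q\big)$ over $\mathbb{Z}[a,q]$. In particular: (a) over $\mathbb{Z}[a,q]$ the matrix $\big((1+a[j]_q)^i\big)_{0\leq i,j\leq n}$ has special Smith normal form $\mathrm{diag}\big(1,a^1q^{\binom12}[1]!_q,\ldots,a^nq^{\binom n2}[n]!_q\big)$; (b) over $\mathbb{Z}[q]$ the matrix $\big([j+1]_q^i\big)_{0\leq i,j\leq n}$ has special Smith normal form $\mathrm{diag}\big(1,q^{\binom22}[1]!_q,q^{\binom32}[2]!_q,\ldots,q^{\binom{n+1}2}[n]!_q\big)$.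
   Context: $[j]_q=1+q+\cdots+q^{j-1}$ (so $[0]_q=0$), $[k]!_q=[1]_q[2]_q\cdots[k]_q$ with $[0]!_q=1$. For an $m\times n$ matrix $A$ over a commutative ring $R$, a matrix $D$ is a special Smith normal form (SSNF) of $A$ over $R$ if there exist $P\in \mathrm{SL}(m,R)$, $Q\in\mathrm{SL}(n,R)$ with $PAQ=D$, $D$ is diagonal, and $d_{ii}$ is a multiple in $R$ of $d_{jj}$ whenever $i\geq j$. -}

module Defs where

open import Level using (0ℓ)
open import Data.Nat using (ℕ; zero; suc; _≤_)
open import Data.Nat.Combinatorics using (_C_)
open import Data.Integer using (ℤ) renaming (_+_ to _+ℤ_; _*_ to _*ℤ_; -_ to -ℤ_; +_ to pos)
open import Data.List using (List; []; _∷_; map)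
open import Data.Fin using (Fin; zero; suc; toℕ; punchIn; fromℕ; _≟_)
open import Data.Product using (Σ; _×_; ∃)
open import Data.Bool using (if_then_else_)
open import Relation.Nullary using (does; ¬_)
open import Relation.Binary.PropositionalEquality using (_≡_)
open import Algebra.Bundles.Raw using (RawRing)

-- Univariate polynomials as coefficient lists (constant term first)
-- over a raw coefficient structure.

module PolyOps {A : Set} (0a : A) (_+a_ _*a_ : A → A → A) (negA : A → A) where
  add : List A → List A → List A
  add [] ys = ys
  add (x ∷ xs) [] = x ∷ xs
  add (x ∷ xs) (y ∷ ys) = (x +a y) ∷ add xs ys

  mul : List A → List A → List A
  mul [] ys = []
  mul (x ∷ xs) ys = add (map (x *a_) ys) (0a ∷ mul xs ys)

  neg : List A → List A
  neg = map negA

  coeff : List A → ℕ → A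
  coeff [] _ = 0a
  coeff (x ∷ xs) zero = x
  coeff (x ∷ xs) (suc i) = coeff xs i

-- ℤ[q]: lists of integers, equality = equality of all coefficients.

module ZqP = PolyOps (pos 0) _+ℤ_ _*ℤ_ -ℤ_

ZqR : RawRing 0ℓ 0ℓ
ZqR = record
  { Carrier = List ℤ
  ; _≈_ = λ p r → ∀ i → ZqP.coeff p i ≡ ZqP.coeff r i
  ; _+_ = ZqP.add
  ; _*_ = ZqP.mul
  ; -_ = ZqP.neg
  ; 0# = []
  ; 1# = pos 1 ∷ []
  }

qZq : List ℤ
qZq = pos 0 ∷ pos 1 ∷ []

-- ℤ[a,q] = (ℤ[q])[a]: lists (indexed by the power of a) of elements of ℤ[q].

module ZaqP = PolyOps {List ℤ} [] ZqP.add ZqP.mul ZqP.neg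

ZaqR : RawRing 0ℓ 0ℓ
ZaqR = record
  { Carrier = List (List ℤ)
  ; _≈_ = λ p r → ∀ i j → ZqP.coeff (ZaqP.coeff p i) j ≡ ZqP.coeff (ZaqP.coeff r i) j
  ; _+_ = ZaqP.add
  ; _*_ = ZaqP.mul
  ; -_ = ZaqP.neg
  ; 0# = []
  ; 1# = (pos 1 ∷ []) ∷ []
  }

aZaq : List (List ℤ)
aZaq = [] ∷ (pos 1 ∷ []) ∷ []

qZaq : List (List ℤ)
qZaq = qZq ∷ []

module Over (R : RawRing 0ℓ 0ℓ) where
  open RawRing R

  sumFin : ∀ {n} → (Fin n → Carrier) → Carrier
  sumFin {zero} f = 0#
  sumFin {suc n} f = f zero + sumFin (λ i → f (suc i))

  pow : Carrier → ℕ → Carrier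
  pow x zero = 1#
  pow x (suc k) = pow x k * x

  qint : Carrier → ℕ → Carrier
  qint q j = sumFin {j} (λ l → pow q (toℕ l))

  qfact : Carrier → ℕ → Carrier
  qfact q zero = 1#
  qfact q (suc k) = qfact q k * qint q (suc k)

  Matrix : ℕ → ℕ → Set
  Matrix m n = Fin m → Fin n → Carrier

  _⊗_ : ∀ {m k n} → Matrix m k → Matrix k n → Matrix m n
  (M ⊗ N) i j = sumFin (λ l → M i l * N l j)

  altSign : ℕ → Carrier → Carrier
  altSign zero x = x
  altSign (suc k) x = - altSign k x

  det : ∀ n → Matrix n n → Carrier
  det zero M = 1#
  det (suc n) M = sumFin (λ j → altSign (toℕ j)
                    (M zero j * det n (λ r c → M (suc r) (punchIn j c))))

  MultipleOf : Carrier → Carrier → Set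
  MultipleOf y x = ∃ λ c → y ≈ c * x

  IsDiagonal : ∀ {m n} → Matrix m n → Set
  IsDiagonal {m} {n} D = ∀ (i : Fin m) (j : Fin n) → ¬ (toℕ i ≡ toℕ j) → D i j ≈ 0#

  DiagDivisibility : ∀ {m n} → Matrix m n → Set
  DiagDivisibility {m} {n} D =
    ∀ (i₁ : Fin m) (j₁ : Fin n) (i₂ : Fin m) (j₂ : Fin n) →
      toℕ i₁ ≡ toℕ j₁ → toℕ i₂ ≡ toℕ j₂ → toℕ i₂ ≤ toℕ i₁ →
      MultipleOf (D i₁ j₁) (D i₂ j₂)

  IsSSNF : ∀ {m n} → Matrix m n → Matrix m n → Set
  IsSSNF {m} {n} A D =
    Σ (Matrix m m) λ P → Σ (Matrix n n) λ Q →
      (det m P ≈ 1#) × (det n Q ≈ 1#) ×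
      (∀ i j → ((P ⊗ A) ⊗ Q) i j ≈ D i j) ×
      IsDiagonal D × DiagDivisibility D

  diagMat : ∀ {n} → (Fin n → Carrier) → Matrix n n
  diagMat d i j = if does (i ≟ j) then d i else 0#

module Zaq = Over ZaqR
module Zq = Over ZqR

gPoly : ∀ {n} → ((i : Fin (suc n)) → Fin (suc (toℕ i)) → List (List ℤ)) →
        Fin (suc n) → List (List ℤ) → List (List ℤ)
gPoly A i x = Zaq.sumFin (λ k → ZaqR ._*_ (A i k)
                 (ZaqR ._*_ (Zaq.pow aZaq (toℕ k)) (Zaq.pow x (toℕ k))))
  where open RawRing

dZaq : ℕ → List (List ℤ)
dZaq i = ZaqR ._*_ (ZaqR ._*_ (Zaq.pow aZaq i) (Zaq.pow qZaq (i C 2))) (Zaq.qfact qZaq i)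
  where open RawRing

dZq : ℕ → List ℤ
dZq i = ZqR ._*_ (Zq.pow qZq (suc i C 2)) (Zq.qfact qZq i)
  where open RawRing

module Submission where

-- The proof is an explicit LDU factorisation.  Put uₘ(x) = aᵐ x (x − [1]_q) ⋯
-- (x − [m−1]_q).  Evaluated at x = [j]_q this equals dₘ [j choose m]_q, where
-- dₘ = aᵐ q^(m choose 2) [m]!_q are the claimed diagonal entries; this rests on the
-- absorption identity ([j]_q − [m]_q) [j choose m]_q = qᵐ [m+1]_q [j choose m+1]_q.
-- Hence t = a[j]_q satisfies t·uₘ = uₘ₊₁ + a[m]_q·uₘ, and so tᵏ = Σₘ S(k,m) uₘ with a
-- lower unitriangular matrix S of generalised Stirling numbers.  Writing the
-- coefficients Aᵢₖ as a lower unitriangular matrix A gives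
--     (gᵢ([j]_q)) = (A · S) · diag(dₘ) · ([j choose m]_q)ₘⱼ,
-- lower unitriangular · diagonal · upper unitriangular.  Inverting the two
-- unitriangular factors (determinant 1) yields the special Smith normal form,
-- since dₘ divides dₘ₊₁.  Part (a) is the same factorisation with t = 1 + a[j]_q
-- (recurrence coefficients 1 + a[m]_q); part (b) is part (a) over ℤ[q] with a = q.

open import Level using (0ℓ)
open import Data.Nat using (ℕ; zero; suc; _<_; _≤_; _≤′_; ≤′-refl; ≤′-step; z≤n; s≤s; _≤?_)
  renaming (_+_ to _+ℕ_)
import Data.Nat.Properties as ℕ
open import Data.Nat.Combinatorics using (_C_; nCk+nC[k+1]≡[n+1]C[k+1]; nC1≡n)
open import Data.Fin using (Fin; toℕ; fromℕ; punchIn) renaming (zero to fzero; suc to fsuc)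
open import Data.Fin.Properties using (toℕ-injective; suc-injective; toℕ<n; toℕ-fromℕ)
open import Data.Integer using (ℤ)
open import Data.Integer.Properties using (+-*-commutativeRing)
open import Data.List using (List; []; _∷_; map)
open import Data.Product using (Σ; _×_; _,_)
open import Data.Empty using (⊥-elim)
open import Function using (_∘_)
open import Relation.Nullary using (yes; no)
open import Relation.Binary.Definitions using (tri<; tri≈; tri>)
open import Relation.Binary.PropositionalEquality as ≡ using (_≡_; _≢_)
open import Algebra.Bundles using (CommutativeRing)
open import Algebra.Bundles.Raw using (RawRing)
open import Algebra.Structures using (IsCommutativeRing)
import Algebra.Properties.Ring as RingProperties
import Algebra.Properties.CommutativeSemigroup as CommutativeSemigroupProperties
import Algebra.Solver.Ring.NaturalCoefficients.Default as NaturalCoefficientSolver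
import Relation.Binary.Reasoning.Setoid as SetoidReasoning
open import Defs

module CoefficientListRing (R : CommutativeRing 0ℓ 0ℓ) where
  open CommutativeRing R hiding (zero)
  open RingProperties ring using (-0#≈0#)
  open CommutativeSemigroupProperties +-commutativeSemigroup using (interchange; x∙yz≈y∙xz)
  open PolyOps 0# _+_ _*_ -_
  open SetoidReasoning setoid

  -- Coefficientwise equality, wrapped in a record so that the two
  -- polynomials can be inferred from an equality proof.
  infix 4 _≋_
  record _≋_ (p r : List Carrier) : Set where
    constructor coeffwise
    field coeff-≈ : ∀ i → coeff p i ≈ coeff r i
  open _≋_

  ≋-refl : ∀ {p} → p ≋ p
  ≋-refl = coeffwise λ _ → refl

  ≋-sym : ∀ {p r} → p ≋ r → r ≋ p
  ≋-sym e = coeffwise λ i → sym (coeff-≈ e i)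

  ≋-trans : ∀ {p r s} → p ≋ r → r ≋ s → p ≋ s
  ≋-trans e f = coeffwise λ i → trans (coeff-≈ e i) (coeff-≈ f i)

  infixr 2 _≋⟨_⟩_
  infix 3 _∎ₚ
  _≋⟨_⟩_ : ∀ p {r s} → p ≋ r → r ≋ s → p ≋ s
  p ≋⟨ e ⟩ f = ≋-trans e f

  _∎ₚ : ∀ p → p ≋ p
  p ∎ₚ = ≋-refl

  scale : Carrier → List Carrier → List Carrier
  scale x = map (x *_)

  coeff-add : ∀ p r i → coeff (add p r) i ≈ coeff p i + coeff r i
  coeff-add []       r        i       = sym (+-identityˡ _)
  coeff-add (x ∷ xs) []       i       = sym (+-identityʳ _)
  coeff-add (x ∷ xs) (y ∷ ys) zero    = refl
  coeff-add (x ∷ xs) (y ∷ ys) (suc i) = coeff-add xs ys i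

  coeff-scale : ∀ x p i → coeff (scale x p) i ≈ x * coeff p i
  coeff-scale x []      i       = sym (zeroʳ x)
  coeff-scale x (y ∷ p) zero    = refl
  coeff-scale x (y ∷ p) (suc i) = coeff-scale x p i

  coeff-neg : ∀ p i → coeff (neg p) i ≈ - coeff p i
  coeff-neg []      i       = sym -0#≈0#
  coeff-neg (y ∷ p) zero    = refl
  coeff-neg (y ∷ p) (suc i) = coeff-neg p i

  shift-cong : ∀ {p r} → p ≋ r → (0# ∷ p) ≋ (0# ∷ r)
  shift-cong e = coeffwise λ { zero → refl ; (suc i) → coeff-≈ e i }

  shift-zero : ∀ {p} → p ≋ [] → (0# ∷ p) ≋ []
  shift-zero e = coeffwise λ { zero → refl ; (suc i) → coeff-≈ e i }

  shift-add : ∀ p r → (0# ∷ add p r) ≋ add (0# ∷ p) (0# ∷ r)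
  shift-add p r = coeffwise λ { zero → sym (+-identityʳ 0#) ; (suc i) → refl }

  shift-scale : ∀ x p → (0# ∷ scale x p) ≋ scale x (0# ∷ p)
  shift-scale x p = coeffwise λ { zero → sym (zeroʳ x) ; (suc i) → refl }

  tail-≋ : ∀ {x p y r} → (x ∷ p) ≋ (y ∷ r) → p ≋ r
  tail-≋ e = coeffwise λ i → coeff-≈ e (suc i)

  tail-≋[] : ∀ {x p} → (x ∷ p) ≋ [] → p ≋ []
  tail-≋[] e = coeffwise λ i → coeff-≈ e (suc i)

  add-cong : ∀ {p p′ r r′} → p ≋ p′ → r ≋ r′ → add p r ≋ add p′ r′
  add-cong {p} {p′} {r} {r′} e f = coeffwise λ i → begin
    coeff (add p r) i       ≈⟨ coeff-add p r i ⟩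
    coeff p i + coeff r i   ≈⟨ +-cong (coeff-≈ e i) (coeff-≈ f i) ⟩
    coeff p′ i + coeff r′ i ≈⟨ coeff-add p′ r′ i ⟨
    coeff (add p′ r′) i     ∎

  scale-cong : ∀ {x x′ p p′} → x ≈ x′ → p ≋ p′ → scale x p ≋ scale x′ p′
  scale-cong {x} {x′} {p} {p′} e f = coeffwise λ i → begin
    coeff (scale x p) i   ≈⟨ coeff-scale x p i ⟩
    x * coeff p i         ≈⟨ *-cong e (coeff-≈ f i) ⟩
    x′ * coeff p′ i       ≈⟨ coeff-scale x′ p′ i ⟨
    coeff (scale x′ p′) i ∎

  neg-cong : ∀ {p p′} → p ≋ p′ → neg p ≋ neg p′
  neg-cong {p} {p′} e = coeffwise λ i →
    trans (coeff-neg p i) (trans (-‿cong (coeff-≈ e i)) (sym (coeff-neg p′ i)))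

  add-assoc : ∀ p r s → add (add p r) s ≋ add p (add r s)
  add-assoc p r s = coeffwise λ i → begin
    coeff (add (add p r) s) i           ≈⟨ trans (coeff-add (add p r) s i) (+-congʳ (coeff-add p r i)) ⟩
    (coeff p i + coeff r i) + coeff s i ≈⟨ +-assoc _ _ _ ⟩
    coeff p i + (coeff r i + coeff s i) ≈⟨ trans (coeff-add p (add r s) i) (+-congˡ (coeff-add r s i)) ⟨
    coeff (add p (add r s)) i           ∎

  add-comm : ∀ p r → add p r ≋ add r p
  add-comm p r = coeffwise λ i →
    trans (coeff-add p r i) (trans (+-comm _ _) (sym (coeff-add r p i)))

  add-identityʳ : ∀ p → add p [] ≋ p
  add-identityʳ p = coeffwise λ i → trans (coeff-add p [] i) (+-identityʳ _)

  neg-inverseˡ : ∀ p → add (neg p) p ≋ []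
  neg-inverseˡ p = coeffwise λ i →
    trans (coeff-add (neg p) p i) (trans (+-congʳ (coeff-neg p i)) (-‿inverseˡ _))

  add-interchange : ∀ p r s t → add (add p r) (add s t) ≋ add (add p s) (add r t)
  add-interchange p r s t = coeffwise λ i → begin
    coeff (add (add p r) (add s t)) i
      ≈⟨ trans (coeff-add (add p r) (add s t) i) (+-cong (coeff-add p r i) (coeff-add s t i)) ⟩
    (coeff p i + coeff r i) + (coeff s i + coeff t i) ≈⟨ interchange _ _ _ _ ⟩
    (coeff p i + coeff s i) + (coeff r i + coeff t i)
      ≈⟨ trans (coeff-add (add p s) (add r t) i) (+-cong (coeff-add p s i) (coeff-add r t i)) ⟨
    coeff (add (add p s) (add r t)) i ∎

  scale-add : ∀ x p r → scale x (add p r) ≋ add (scale x p) (scale x r)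
  scale-add x p r = coeffwise λ i → begin
    coeff (scale x (add p r)) i   ≈⟨ trans (coeff-scale x (add p r) i) (*-congˡ (coeff-add p r i)) ⟩
    x * (coeff p i + coeff r i)   ≈⟨ distribˡ x _ _ ⟩
    x * coeff p i + x * coeff r i ≈⟨ trans (coeff-add (scale x p) (scale x r) i) (+-cong (coeff-scale x p i) (coeff-scale x r i)) ⟨
    coeff (add (scale x p) (scale x r)) i ∎

  scale-+ : ∀ x y p → scale (x + y) p ≋ add (scale x p) (scale y p)
  scale-+ x y p = coeffwise λ i → begin
    coeff (scale (x + y) p) i     ≈⟨ coeff-scale (x + y) p i ⟩
    (x + y) * coeff p i           ≈⟨ distribʳ _ x y ⟩
    x * coeff p i + y * coeff p i ≈⟨ trans (coeff-add (scale x p) (scale y p) i) (+-cong (coeff-scale x p i) (coeff-scale y p i)) ⟨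
    coeff (add (scale x p) (scale y p)) i ∎

  scale-scale : ∀ x y p → scale x (scale y p) ≋ scale (x * y) p
  scale-scale x y p = coeffwise λ i → begin
    coeff (scale x (scale y p)) i ≈⟨ trans (coeff-scale x (scale y p) i) (*-congˡ (coeff-scale y p i)) ⟩
    x * (y * coeff p i)           ≈⟨ *-assoc x y _ ⟨
    (x * y) * coeff p i           ≈⟨ coeff-scale (x * y) p i ⟨
    coeff (scale (x * y) p) i     ∎

  scale-0 : ∀ r → scale 0# r ≋ []
  scale-0 r = coeffwise λ i → trans (coeff-scale 0# r i) (zeroˡ _)

  scale-1 : ∀ r → scale 1# r ≋ r
  scale-1 r = coeffwise λ i → trans (coeff-scale 1# r i) (*-identityˡ _)

  mul-zeroˡ : ∀ {p} r → p ≋ [] → mul p r ≋ []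
  mul-zeroˡ {[]}     r e = ≋-refl
  mul-zeroˡ {x ∷ xs} r e =
    add (scale x r) (0# ∷ mul xs r) ≋⟨ add-cong (scale-cong (coeff-≈ e zero) ≋-refl)
                                                (shift-zero (mul-zeroˡ r (tail-≋[] e))) ⟩
    add (scale 0# r) []             ≋⟨ ≋-trans (add-identityʳ (scale 0# r)) (scale-0 r) ⟩
    []                              ∎ₚ

  mul-zeroʳ : ∀ p → mul p [] ≋ []
  mul-zeroʳ []       = ≋-refl
  mul-zeroʳ (x ∷ xs) = shift-zero (mul-zeroʳ xs)

  mul-congˡ : ∀ {p p′} r → p ≋ p′ → mul p r ≋ mul p′ r
  mul-congˡ {[]}    {_}       r e = ≋-sym (mul-zeroˡ r (≋-sym e))
  mul-congˡ {_ ∷ _} {[]}      r e = mul-zeroˡ r e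
  mul-congˡ {_ ∷ _} {_ ∷ _}   r e =
    add-cong (scale-cong (coeff-≈ e zero) ≋-refl) (shift-cong (mul-congˡ r (tail-≋ e)))

  mul-congʳ : ∀ p {r r′} → r ≋ r′ → mul p r ≋ mul p r′
  mul-congʳ []      e = ≋-refl
  mul-congʳ (x ∷ p) e = add-cong (scale-cong refl e) (shift-cong (mul-congʳ p e))

  mul-cong : ∀ {p p′ r r′} → p ≋ p′ → r ≋ r′ → mul p r ≋ mul p′ r′
  mul-cong {p′ = p′} {r} e f = ≋-trans (mul-congˡ r e) (mul-congʳ p′ f)

  mul-shift : ∀ p r → mul (0# ∷ p) r ≋ (0# ∷ mul p r)
  mul-shift p r = add-cong (scale-0 r) ≋-refl

  mul-scale : ∀ x p r → mul (scale x p) r ≋ scale x (mul p r)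
  mul-scale x []      r = ≋-refl
  mul-scale x (y ∷ p) r =
    add (scale (x * y) r) (0# ∷ mul (scale x p) r)
      ≋⟨ add-cong (≋-sym (scale-scale x y r)) (≋-trans (shift-cong (mul-scale x p r)) (shift-scale x (mul p r))) ⟩
    add (scale x (scale y r)) (scale x (0# ∷ mul p r))
      ≋⟨ ≋-sym (scale-add x (scale y r) (0# ∷ mul p r)) ⟩
    scale x (add (scale y r) (0# ∷ mul p r)) ∎ₚ

  mul-distribʳ : ∀ p p′ r → mul (add p p′) r ≋ add (mul p r) (mul p′ r)
  mul-distribʳ []       p′       r = ≋-refl
  mul-distribʳ (x ∷ xs) []       r = ≋-sym (add-identityʳ (mul (x ∷ xs) r))
  mul-distribʳ (x ∷ xs) (y ∷ ys) r =
    add (scale (x + y) r) (0# ∷ mul (add xs ys) r)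
      ≋⟨ add-cong (scale-+ x y r) (≋-trans (shift-cong (mul-distribʳ xs ys r)) (shift-add (mul xs r) (mul ys r))) ⟩
    add (add (scale x r) (scale y r)) (add (0# ∷ mul xs r) (0# ∷ mul ys r))
      ≋⟨ add-interchange (scale x r) (scale y r) (0# ∷ mul xs r) (0# ∷ mul ys r) ⟩
    add (add (scale x r) (0# ∷ mul xs r)) (add (scale y r) (0# ∷ mul ys r)) ∎ₚ

  mul-assoc : ∀ p r s → mul (mul p r) s ≋ mul p (mul r s)
  mul-assoc []       r s = ≋-refl
  mul-assoc (x ∷ xs) r s =
    mul (add (scale x r) (0# ∷ mul xs r)) s
      ≋⟨ mul-distribʳ (scale x r) _ s ⟩
    add (mul (scale x r) s) (mul (0# ∷ mul xs r) s)
      ≋⟨ add-cong (mul-scale x r s) (≋-trans (mul-shift (mul xs r) s) (shift-cong (mul-assoc xs r s))) ⟩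
    add (scale x (mul r s)) (0# ∷ mul xs (mul r s)) ∎ₚ

  -- the recursion of 'mul' on its second argument, the key to commutativity
  mul-consʳ : ∀ p y ys → mul p (y ∷ ys) ≋ add (scale y p) (0# ∷ mul p ys)
  mul-consʳ []       y ys = coeffwise λ { zero → refl ; (suc i) → refl }
  mul-consʳ (x ∷ xs) y ys =
    add (scale x (y ∷ ys)) (0# ∷ mul xs (y ∷ ys))
      ≋⟨ add-cong (≋-refl {scale x (y ∷ ys)}) (shift-cong (mul-consʳ xs y ys)) ⟩
    add (scale x (y ∷ ys)) (0# ∷ add (scale y xs) rest)
      ≋⟨ coeffwise swap ⟩
    add (scale y (x ∷ xs)) (0# ∷ add (scale x ys) rest) ∎ₚ
    where
    rest : List Carrier
    rest = 0# ∷ mul xs ys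
    swap : ∀ i → coeff (add (scale x (y ∷ ys)) (0# ∷ add (scale y xs) rest)) i
               ≈ coeff (add (scale y (x ∷ xs)) (0# ∷ add (scale x ys) rest)) i
    swap zero    = +-congʳ (*-comm x y)
    swap (suc i) = begin
      coeff (add (scale x ys) (add (scale y xs) rest)) i
        ≈⟨ trans (coeff-add (scale x ys) (add (scale y xs) rest) i) (+-congˡ (coeff-add (scale y xs) rest i)) ⟩
      coeff (scale x ys) i + (coeff (scale y xs) i + coeff rest i) ≈⟨ x∙yz≈y∙xz _ _ _ ⟩
      coeff (scale y xs) i + (coeff (scale x ys) i + coeff rest i)
        ≈⟨ trans (coeff-add (scale y xs) (add (scale x ys) rest) i) (+-congˡ (coeff-add (scale x ys) rest i)) ⟨
      coeff (add (scale y xs) (add (scale x ys) rest)) i ∎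

  mul-comm : ∀ p r → mul p r ≋ mul r p
  mul-comm []       r = ≋-sym (mul-zeroʳ r)
  mul-comm (x ∷ xs) r =
    ≋-trans (add-cong (≋-refl {scale x r}) (shift-cong (mul-comm xs r))) (≋-sym (mul-consʳ r x xs))

  mul-identityˡ : ∀ r → mul (1# ∷ []) r ≋ r
  mul-identityˡ r = ≋-trans (add-cong (scale-1 r) (shift-zero ≋-refl)) (add-identityʳ r)

  polynomial-isCommutativeRing : IsCommutativeRing (λ p r → ∀ i → coeff p i ≈ coeff r i)
                                        add mul neg [] (1# ∷ [])
  polynomial-isCommutativeRing = record
    { isRing = record
      { +-isAbelianGroup = record
        { isGroup = record
          { isMonoid = record
            { isSemigroup = record
              { isMagma = record
                { isEquivalence = record
                  { refl  = λ {p} → coeff-≈ (≋-refl {p})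
                  ; sym   = λ {p} {r} e → coeff-≈ (≋-sym {p} {r} (coeffwise e))
                  ; trans = λ {p} {r} {s} e f → coeff-≈ (≋-trans {p} {r} {s} (coeffwise e) (coeffwise f))
                  }
                ; ∙-cong = λ {p} {p′} {r} {r′} e f →
                    coeff-≈ (add-cong {p} {p′} {r} {r′} (coeffwise e) (coeffwise f))
                }
              ; assoc = λ p r s → coeff-≈ (add-assoc p r s)
              }
            ; identity = (λ p → coeff-≈ (≋-refl {p})) , (λ p → coeff-≈ (add-identityʳ p))
            }
          ; inverse = (λ p → coeff-≈ (neg-inverseˡ p))
                    , (λ p → coeff-≈ (≋-trans (add-comm p (neg p)) (neg-inverseˡ p)))
          ; ⁻¹-cong = λ {p} {r} e → coeff-≈ (neg-cong {p} {r} (coeffwise e))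
          }
        ; comm = λ p r → coeff-≈ (add-comm p r)
        }
      ; *-cong = λ {p} {p′} {r} {r′} e f → coeff-≈ (mul-cong {p} {p′} {r} {r′} (coeffwise e) (coeffwise f))
      ; *-assoc = λ p r s → coeff-≈ (mul-assoc p r s)
      ; *-identity = (λ r → coeff-≈ (mul-identityˡ r))
                   , (λ r → coeff-≈ (≋-trans (mul-comm r (1# ∷ [])) (mul-identityˡ r)))
      ; distrib = (λ p r s → coeff-≈ (≋-trans (mul-comm p _)
                                      (≋-trans (mul-distribʳ r s p) (add-cong (mul-comm r p) (mul-comm s p)))))
                , (λ p r s → coeff-≈ (mul-distribʳ r s p))
      }
    ; *-comm = λ p r → coeff-≈ (mul-comm p r)
    }

  polynomialRing : CommutativeRing 0ℓ 0ℓ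
  polynomialRing = record { isCommutativeRing = polynomial-isCommutativeRing }

module Matrices (R : CommutativeRing 0ℓ 0ℓ) where
  open CommutativeRing R hiding (zero)
  open RingProperties ring using (-0#≈0#)
  open CommutativeSemigroupProperties +-commutativeSemigroup using (interchange)
  open Over rawRing
  open SetoidReasoning setoid

  sum-cong : ∀ {n} {f g : Fin n → Carrier} → (∀ i → f i ≈ g i) → sumFin f ≈ sumFin g
  sum-cong {zero}  e = refl
  sum-cong {suc n} e = +-cong (e fzero) (sum-cong (λ i → e (fsuc i)))

  sum-zero : ∀ {n} {f : Fin n → Carrier} → (∀ i → f i ≈ 0#) → sumFin f ≈ 0#
  sum-zero {zero}  e = refl
  sum-zero {suc n} e = trans (+-cong (e fzero) (sum-zero (λ i → e (fsuc i)))) (+-identityˡ 0#)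

  sum-+ : ∀ {n} (f g : Fin n → Carrier) → sumFin (λ i → f i + g i) ≈ sumFin f + sumFin g
  sum-+ {zero}  f g = sym (+-identityˡ 0#)
  sum-+ {suc n} f g =
    trans (+-congˡ (sum-+ (λ i → f (fsuc i)) (λ i → g (fsuc i)))) (interchange _ _ _ _)

  *-sumˡ : ∀ {n} c (f : Fin n → Carrier) → c * sumFin f ≈ sumFin (λ i → c * f i)
  *-sumˡ {zero}  c f = zeroʳ c
  *-sumˡ {suc n} c f = trans (distribˡ c _ _) (+-congˡ (*-sumˡ c (λ i → f (fsuc i))))

  *-sumʳ : ∀ {n} c (f : Fin n → Carrier) → sumFin f * c ≈ sumFin (λ i → f i * c)
  *-sumʳ {zero}  c f = zeroˡ c
  *-sumʳ {suc n} c f = trans (distribʳ c _ _) (+-congˡ (*-sumʳ c (λ i → f (fsuc i))))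

  sum-swap : ∀ {m n} (f : Fin m → Fin n → Carrier) →
             sumFin (λ i → sumFin (λ j → f i j)) ≈ sumFin (λ j → sumFin (λ i → f i j))
  sum-swap {zero} {n} f = sym (sum-zero {n} (λ _ → refl))
  sum-swap {suc m} f = trans (+-congˡ (sum-swap (λ i j → f (fsuc i) j)))
                             (sym (sum-+ (λ j → f fzero j) (λ j → sumFin (λ i → f (fsuc i) j))))

  sum-single : ∀ {n} (f : Fin n → Carrier) (i : Fin n) → (∀ j → j ≢ i → f j ≈ 0#) → sumFin f ≈ f i
  sum-single f fzero    off =
    trans (+-congˡ (sum-zero (λ j → off (fsuc j) λ ()))) (+-identityʳ _)
  sum-single f (fsuc i) off =
    trans (+-cong (off fzero λ ()) (sum-single (λ j → f (fsuc j)) i (λ j ne → off (fsuc j) (ne ∘ suc-injective))))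
          (+-identityˡ _)

  extend : ∀ {m} → (Fin m → Carrier) → ℕ → Carrier
  extend {zero}  f k       = 0#
  extend {suc m} f zero    = f fzero
  extend {suc m} f (suc k) = extend (λ i → f (fsuc i)) k

  extend-toℕ : ∀ {m} (f : Fin m → Carrier) (k : Fin m) → extend f (toℕ k) ≡ f k
  extend-toℕ f fzero    = ≡.refl
  extend-toℕ f (fsuc k) = extend-toℕ (λ i → f (fsuc i)) k

  extend-beyond : ∀ {m} (f : Fin m → Carrier) k → m ≤ k → extend f k ≈ 0#
  extend-beyond {zero}  f k       _         = refl
  extend-beyond {suc m} f (suc k) (s≤s m≤k) = extend-beyond (λ i → f (fsuc i)) k m≤k

  sum-extend : ∀ {m N} (f : Fin m → Carrier) (g : ℕ → Carrier) → m ≤ N →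
               sumFin (λ k → f k * g (toℕ k)) ≈ sumFin {N} (λ k → extend f (toℕ k) * g (toℕ k))
  sum-extend {zero}  {N}     f g _         = sym (sum-zero {N} (λ k → zeroˡ (g (toℕ k))))
  sum-extend {suc m} {suc N} f g (s≤s m≤N) =
    +-congˡ (sum-extend (λ i → f (fsuc i)) (λ k → g (suc k)) m≤N)

  infix 4 _≈ₘ_
  record _≈ₘ_ {m n} (A B : Matrix m n) : Set where
    constructor entrywise
    field entry : ∀ i j → A i j ≈ B i j
  open _≈ₘ_ public

  ≈ₘ-refl : ∀ {m n} {A : Matrix m n} → A ≈ₘ A
  ≈ₘ-refl = entrywise λ _ _ → refl

  ≈ₘ-sym : ∀ {m n} {A B : Matrix m n} → A ≈ₘ B → B ≈ₘ A
  ≈ₘ-sym e = entrywise λ i j → sym (entry e i j)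

  infixr 2 _≈ₘ⟨_⟩_
  infix 3 _∎ₘ
  _≈ₘ⟨_⟩_ : ∀ {m n} (A : Matrix m n) {B C} → A ≈ₘ B → B ≈ₘ C → A ≈ₘ C
  A ≈ₘ⟨ e ⟩ f = entrywise λ i j → trans (entry e i j) (entry f i j)

  _∎ₘ : ∀ {m n} (A : Matrix m n) → A ≈ₘ A
  A ∎ₘ = ≈ₘ-refl

  ⊗-cong : ∀ {m k n} {A A′ : Matrix m k} {B B′ : Matrix k n} → A ≈ₘ A′ → B ≈ₘ B′ → A ⊗ B ≈ₘ A′ ⊗ B′
  ⊗-cong e f = entrywise λ i j → sum-cong (λ l → *-cong (entry e i l) (entry f l j))

  ⊗-congˡ : ∀ {m k n} {A A′ : Matrix m k} (B : Matrix k n) → A ≈ₘ A′ → A ⊗ B ≈ₘ A′ ⊗ B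
  ⊗-congˡ B e = ⊗-cong e (≈ₘ-refl {A = B})

  ⊗-congʳ : ∀ {m k n} (A : Matrix m k) {B B′ : Matrix k n} → B ≈ₘ B′ → A ⊗ B ≈ₘ A ⊗ B′
  ⊗-congʳ A e = ⊗-cong (≈ₘ-refl {A = A}) e

  ⊗-assoc : ∀ {m k l n} (A : Matrix m k) (B : Matrix k l) (C : Matrix l n) →
            (A ⊗ B) ⊗ C ≈ₘ A ⊗ (B ⊗ C)
  ⊗-assoc A B C = entrywise λ i j → begin
    sumFin (λ l → sumFin (λ k → A i k * B k l) * C l j)
      ≈⟨ sum-cong (λ l → *-sumʳ (C l j) (λ k → A i k * B k l)) ⟩
    sumFin (λ l → sumFin (λ k → (A i k * B k l) * C l j))
      ≈⟨ sum-swap (λ l k → (A i k * B k l) * C l j) ⟩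
    sumFin (λ k → sumFin (λ l → (A i k * B k l) * C l j))
      ≈⟨ sum-cong (λ k → sum-cong (λ l → *-assoc (A i k) (B k l) (C l j))) ⟩
    sumFin (λ k → sumFin (λ l → A i k * (B k l * C l j)))
      ≈⟨ sum-cong (λ k → *-sumˡ (A i k) (λ l → B k l * C l j)) ⟨
    sumFin (λ k → A i k * sumFin (λ l → B k l * C l j)) ∎

  transpose : ∀ {m n} → Matrix m n → Matrix n m
  transpose A i j = A j i

  transpose-⊗ : ∀ {m k n} (A : Matrix m k) (B : Matrix k n) →
                transpose (A ⊗ B) ≈ₘ transpose B ⊗ transpose A
  transpose-⊗ A B = entrywise λ i j → sum-cong (λ l → *-comm (A j l) (B l i))

  identity : ∀ {n} → Matrix n n
  identity fzero    fzero    = 1#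
  identity fzero    (fsuc _) = 0#
  identity (fsuc _) fzero    = 0#
  identity (fsuc i) (fsuc j) = identity i j

  identity-⊗ : ∀ {n k} (A : Matrix n k) → identity ⊗ A ≈ₘ A
  identity-⊗ {zero}  A = entrywise λ ()
  identity-⊗ {suc n} A = entrywise row
    where
    row : ∀ i j → (identity ⊗ A) i j ≈ A i j
    row fzero    j = trans (+-cong (*-identityˡ _) (sum-zero (λ l → zeroˡ (A (fsuc l) j)))) (+-identityʳ _)
    row (fsuc i) j = trans (+-cong (zeroˡ _) (entry (identity-⊗ (λ r c → A (fsuc r) c)) i j)) (+-identityˡ _)

  ⊗-identity : ∀ {n k} (A : Matrix k n) → A ⊗ identity ≈ₘ A
  ⊗-identity {zero}  A = entrywise λ _ ()
  ⊗-identity {suc n} A = entrywise column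
    where
    column : ∀ i j → (A ⊗ identity) i j ≈ A i j
    column i fzero    = trans (+-cong (*-identityʳ _) (sum-zero (λ l → zeroʳ (A i (fsuc l))))) (+-identityʳ _)
    column i (fsuc j) = trans (+-cong (zeroʳ _) (entry (⊗-identity (λ r c → A r (fsuc c))) i j)) (+-identityˡ _)

  diagMat-identity : ∀ {n} (d : Fin n → Carrier) i j → diagMat d i j ≈ d i * identity i j
  diagMat-identity d fzero    fzero    = sym (*-identityʳ _)
  diagMat-identity d fzero    (fsuc j) = sym (zeroʳ _)
  diagMat-identity d (fsuc i) fzero    = sym (zeroʳ _)
  diagMat-identity d (fsuc i) (fsuc j) = diagMat-identity (λ k → d (fsuc k)) i j

  diagMat-diagonal : ∀ {n} (d : Fin n → Carrier) i → diagMat d i i ≈ d i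
  diagMat-diagonal d fzero    = refl
  diagMat-diagonal d (fsuc i) = diagMat-diagonal (λ k → d (fsuc k)) i

  diagMat-isDiagonal : ∀ {n} (d : Fin n → Carrier) → IsDiagonal (diagMat d)
  diagMat-isDiagonal d i j ne = trans (diagMat-identity d i j) (trans (*-congˡ (off i j ne)) (zeroʳ _))
    where
    off : ∀ {n} (i j : Fin n) → toℕ i ≢ toℕ j → identity i j ≈ 0#
    off fzero    fzero    ne = ⊥-elim (ne ≡.refl)
    off fzero    (fsuc j) ne = refl
    off (fsuc i) fzero    ne = refl
    off (fsuc i) (fsuc j) ne = off i j (ne ∘ ≡.cong suc)

  diagMat-⊗ : ∀ {n k} (d : Fin n → Carrier) (A : Matrix n k) →
              diagMat d ⊗ A ≈ₘ (λ i j → d i * A i j)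
  diagMat-⊗ d A = entrywise λ i j → begin
    sumFin (λ l → diagMat d i l * A l j)
      ≈⟨ sum-cong (λ l → trans (*-congʳ (diagMat-identity d i l)) (*-assoc _ _ _)) ⟩
    sumFin (λ l → d i * (identity i l * A l j)) ≈⟨ *-sumˡ (d i) (λ l → identity i l * A l j) ⟨
    d i * (identity ⊗ A) i j                    ≈⟨ *-congˡ (entry (identity-⊗ A) i j) ⟩
    d i * A i j                                 ∎

  MultipleOf-resp : ∀ {y y′ x x′} → y ≈ y′ → x ≈ x′ → MultipleOf y′ x′ → MultipleOf y x
  MultipleOf-resp ey ex (c , e) = c , trans ey (trans e (*-congˡ (sym ex)))

  DivisibilityChain : ∀ {n} → (Fin n → Carrier) → Set
  DivisibilityChain d = ∀ i j → toℕ j ≤ toℕ i → MultipleOf (d i) (d j)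

  diagMat-divisibility : ∀ {n} (d : Fin n → Carrier) → DivisibilityChain d → DiagDivisibility (diagMat d)
  diagMat-divisibility d chain i₁ j₁ i₂ j₂ e₁ e₂ le
    with toℕ-injective e₁ | toℕ-injective e₂
  ... | ≡.refl | ≡.refl =
    MultipleOf-resp (diagMat-diagonal d i₁) (diagMat-diagonal d i₂) (chain i₁ i₂ le)

  record LowerUnitriangular {n} (M : Matrix n n) : Set where
    field
      above-zero   : ∀ i j → toℕ i < toℕ j → M i j ≈ 0#
      diagonal-one : ∀ i → M i i ≈ 1#
  open LowerUnitriangular

  UpperUnitriangular : ∀ {n} → Matrix n n → Set
  UpperUnitriangular M = LowerUnitriangular (transpose M)

  lower-tail : ∀ {n} {M : Matrix (suc n) (suc n)} → LowerUnitriangular M →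
               LowerUnitriangular (λ r c → M (fsuc r) (fsuc c))
  lower-tail L = record { above-zero   = λ i j lt → above-zero L (fsuc i) (fsuc j) (s≤s lt)
                        ; diagonal-one = λ i → diagonal-one L (fsuc i) }

  ⊗-lower : ∀ {n} {A B : Matrix n n} → LowerUnitriangular A → LowerUnitriangular B →
            LowerUnitriangular (A ⊗ B)
  ⊗-lower {A = A} {B} LA LB = record { above-zero = above ; diagonal-one = diagonal }
    where
    above : ∀ i j → toℕ i < toℕ j → (A ⊗ B) i j ≈ 0#
    above i j i<j = sum-zero term
      where
      term : ∀ l → A i l * B l j ≈ 0#
      term l with toℕ l ≤? toℕ i
      ... | yes l≤i = trans (*-congˡ (above-zero LB l j (ℕ.≤-<-trans l≤i i<j))) (zeroʳ _)
      ... | no  l≰i = trans (*-congʳ (above-zero LA i l (ℕ.≰⇒> l≰i))) (zeroˡ _)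

    diagonal : ∀ i → (A ⊗ B) i i ≈ 1#
    diagonal i = begin
      sumFin (λ l → A i l * B l i) ≈⟨ sum-single (λ l → A i l * B l i) i off ⟩
      A i i * B i i                ≈⟨ *-cong (diagonal-one LA i) (diagonal-one LB i) ⟩
      1# * 1#                      ≈⟨ *-identityˡ 1# ⟩
      1#                           ∎
      where
      off : ∀ l → l ≢ i → A i l * B l i ≈ 0#
      off l l≢i with ℕ.<-cmp (toℕ l) (toℕ i)
      ... | tri< l<i _ _ = trans (*-congˡ (above-zero LB l i l<i)) (zeroʳ _)
      ... | tri≈ _ e _   = ⊥-elim (l≢i (toℕ-injective e))
      ... | tri> _ _ i<l = trans (*-congʳ (above-zero LA i l i<l)) (zeroˡ _)

  altSign-zero : ∀ k {x} → x ≈ 0# → altSign k x ≈ 0#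
  altSign-zero zero    e = e
  altSign-zero (suc k) e = trans (-‿cong (altSign-zero k e)) -0#≈0#

  minor : ∀ {n} → Matrix (suc n) (suc n) → Fin (suc n) → Matrix n n
  minor M j r c = M (fsuc r) (punchIn j c)

  det-first-term : ∀ n (M : Matrix (suc n) (suc n)) →
                   (∀ j → M fzero (fsuc j) * det n (minor M (fsuc j)) ≈ 0#) →
                   det (suc n) M ≈ M fzero fzero * det n (minor M fzero)
  det-first-term n M rest =
    trans (+-congˡ (sum-zero (λ j → altSign-zero (suc (toℕ j)) (rest j)))) (+-identityʳ _)

  det-zero-column : ∀ n (M : Matrix (suc n) (suc n)) → (∀ r → M r fzero ≈ 0#) → det (suc n) M ≈ 0#
  det-zero-column zero    M col = trans (+-identityʳ _) (trans (*-congʳ (col fzero)) (zeroˡ _))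
  det-zero-column (suc n) M col = begin
    det (suc (suc n)) M                        ≈⟨ det-first-term (suc n) M rest ⟩
    M fzero fzero * det (suc n) (minor M fzero) ≈⟨ trans (*-congʳ (col fzero)) (zeroˡ _) ⟩
    0#                                         ∎
    where
    rest : ∀ j → M fzero (fsuc j) * det (suc n) (minor M (fsuc j)) ≈ 0#
    rest j = trans (*-congˡ (det-zero-column n (minor M (fsuc j)) (λ r → col (fsuc r)))) (zeroʳ _)

  det-lower : ∀ n (M : Matrix n n) → LowerUnitriangular M → det n M ≈ 1#
  det-lower zero    M L = refl
  det-lower (suc n) M L = begin
    det (suc n) M                         ≈⟨ det-first-term n M rest ⟩
    M fzero fzero * det n (minor M fzero) ≈⟨ *-cong (diagonal-one L fzero) (det-lower n _ (lower-tail L)) ⟩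
    1# * 1#                               ≈⟨ *-identityˡ 1# ⟩
    1#                                    ∎
    where
    rest : ∀ j → M fzero (fsuc j) * det n (minor M (fsuc j)) ≈ 0#
    rest j = trans (*-congʳ (above-zero L fzero (fsuc j) (s≤s z≤n))) (zeroˡ _)

  det-upper : ∀ n (M : Matrix n n) → UpperUnitriangular M → det n M ≈ 1#
  det-upper zero    M U = refl
  det-upper (suc n) M U = begin
    det (suc n) M                         ≈⟨ det-first-term n M (rest n M (λ r → above-zero U fzero (fsuc r) (s≤s z≤n))) ⟩
    M fzero fzero * det n (minor M fzero) ≈⟨ *-cong (diagonal-one U fzero) (det-upper n _ (lower-tail U)) ⟩
    1# * 1#                               ≈⟨ *-identityˡ 1# ⟩
    1#                                    ∎
    where
    -- the first column of M vanishes below the corner, so every minor but the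
    -- first has a zero column
    rest : ∀ n (M : Matrix (suc n) (suc n)) → (∀ r → M (fsuc r) fzero ≈ 0#) →
           ∀ j → M fzero (fsuc j) * det n (minor M (fsuc j)) ≈ 0#
    rest (suc n) M col j = trans (*-congˡ (det-zero-column n (minor M (fsuc j)) col)) (zeroʳ _)

  bordered : ∀ {n} → Carrier → (Fin n → Carrier) → (Fin n → Carrier) → Matrix n n → Matrix (suc n) (suc n)
  bordered a w v M fzero    fzero    = a
  bordered a w v M fzero    (fsuc c) = w c
  bordered a w v M (fsuc r) fzero    = v r
  bordered a w v M (fsuc r) (fsuc c) = M r c

  -- a lower unitriangular matrix has a lower unitriangular left inverse,
  -- built by bordering the inverse of its lower-right block
  lower-inverse : ∀ n (L : Matrix n n) → LowerUnitriangular L →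
                  Σ (Matrix n n) λ P → LowerUnitriangular P × (P ⊗ L ≈ₘ identity)
  lower-inverse zero    L _ = (λ ()) , record { above-zero = λ () ; diagonal-one = λ () } , entrywise λ ()
  lower-inverse (suc n) L LL with lower-inverse n (minor L fzero) (lower-tail LL)
  ... | P′ , LP′ , P′L≈I = P , LP , entrywise inverse
    where
    X : Fin n → Carrier
    X r = sumFin (λ l → P′ r l * L (fsuc l) fzero)

    P : Matrix (suc n) (suc n)
    P = bordered 1# (λ _ → 0#) (λ r → - X r) P′

    LP : LowerUnitriangular P
    LP = record { above-zero = above ; diagonal-one = diagonal }
      where
      above : ∀ i j → toℕ i < toℕ j → P i j ≈ 0#
      above fzero    (fsuc c) _         = refl
      above (fsuc r) (fsuc c) (s≤s r<c) = above-zero LP′ r c r<c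
      diagonal : ∀ i → P i i ≈ 1#
      diagonal fzero    = refl
      diagonal (fsuc r) = diagonal-one LP′ r

    first-row-zero : ∀ c → L fzero (fsuc c) ≈ 0#
    first-row-zero c = above-zero LL fzero (fsuc c) (s≤s z≤n)

    top-row : ∀ j → 1# * L fzero j + sumFin (λ l → 0# * L (fsuc l) j) ≈ L fzero j
    top-row j = trans (+-cong (*-identityˡ _) (sum-zero (λ l → zeroˡ (L (fsuc l) j)))) (+-identityʳ _)

    inverse : ∀ i j → (P ⊗ L) i j ≈ identity i j
    inverse fzero    fzero    = trans (top-row fzero) (diagonal-one LL fzero)
    inverse fzero    (fsuc c) = trans (top-row (fsuc c)) (first-row-zero c)
    inverse (fsuc r) fzero    =
      trans (+-congʳ (trans (*-congˡ (diagonal-one LL fzero)) (*-identityʳ _))) (-‿inverseˡ _)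
    inverse (fsuc r) (fsuc c) =
      trans (+-congʳ (trans (*-congˡ (first-row-zero c)) (zeroʳ _)))
            (trans (+-identityˡ _) (entry P′L≈I r c))

  transpose-identity : ∀ {n} → transpose (identity {n}) ≈ₘ identity
  transpose-identity = entrywise symmetric
    where
    symmetric : ∀ {n} (i j : Fin n) → identity j i ≈ identity i j
    symmetric fzero    fzero    = refl
    symmetric fzero    (fsuc j) = refl
    symmetric (fsuc i) fzero    = refl
    symmetric (fsuc i) (fsuc j) = symmetric i j

  upper-inverse : ∀ n (U : Matrix n n) → UpperUnitriangular U →
                  Σ (Matrix n n) λ Q → UpperUnitriangular Q × (U ⊗ Q ≈ₘ identity)
  upper-inverse n U UU with lower-inverse n (transpose U) UU
  ... | P , LP , PUᵀ≈I = transpose P , LP ,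
    (U ⊗ transpose P             ≈ₘ⟨ ≈ₘ-sym (transpose-⊗ P (transpose U)) ⟩
     transpose (P ⊗ transpose U) ≈ₘ⟨ entrywise (λ i j → entry PUᵀ≈I j i) ⟩
     transpose identity          ≈ₘ⟨ transpose-identity ⟩
     identity                    ∎ₘ)

  -- The special Smith normal form of an LDU product: if M = L D U with L
  -- lower and U upper unitriangular, then P = L⁻¹ and Q = U⁻¹ have
  -- determinant 1 and P M Q = D.
  ssnf-of-LDU : ∀ n (M L U : Matrix n n) (d : Fin n → Carrier) →
                LowerUnitriangular L → UpperUnitriangular U →
                M ≈ₘ L ⊗ (diagMat d ⊗ U) → DivisibilityChain d →
                IsSSNF M (diagMat d)
  ssnf-of-LDU n M L U d LL UU M≈LDU chain
    with lower-inverse n L LL | upper-inverse n U UU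
  ... | P , LP , PL≈I | Q , UQ , UQ≈I =
    P , Q , det-lower n P LP , det-upper n Q UQ , entry PMQ≈D ,
    diagMat-isDiagonal d , diagMat-divisibility d chain
    where
    D : Matrix n n
    D = diagMat d
    PMQ≈D : (P ⊗ M) ⊗ Q ≈ₘ D
    PMQ≈D =
      (P ⊗ M) ⊗ Q                 ≈ₘ⟨ ⊗-congˡ Q (⊗-congʳ P M≈LDU) ⟩
      (P ⊗ (L ⊗ (D ⊗ U))) ⊗ Q     ≈ₘ⟨ ⊗-congˡ Q (≈ₘ-sym (⊗-assoc P L (D ⊗ U))) ⟩
      ((P ⊗ L) ⊗ (D ⊗ U)) ⊗ Q     ≈ₘ⟨ ⊗-congˡ Q (⊗-congˡ (D ⊗ U) PL≈I) ⟩
      (identity ⊗ (D ⊗ U)) ⊗ Q    ≈ₘ⟨ ⊗-congˡ Q (identity-⊗ (D ⊗ U)) ⟩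
      (D ⊗ U) ⊗ Q                 ≈ₘ⟨ ⊗-assoc D U Q ⟩
      D ⊗ (U ⊗ Q)                 ≈ₘ⟨ ⊗-congʳ D UQ≈I ⟩
      D ⊗ identity                ≈ₘ⟨ ⊗-identity D ⟩
      D                           ∎ₘ

-- Expanding powers of t in a basis u₀ = 1, u₁, u₂, … satisfying the
-- recurrence  t · uₘ = uₘ₊₁ + λₘ · uₘ.  The coefficients are generalised
-- Stirling numbers of the second kind (λₘ = m gives the classical ones, uₘ
-- being the falling factorial of t).
module PowerExpansion (R : CommutativeRing 0ℓ 0ℓ) (λ′ : ℕ → CommutativeRing.Carrier R) where
  open CommutativeRing R hiding (zero)
  open CommutativeSemigroupProperties +-commutativeSemigroup using (x∙yz≈y∙xz)
  open NaturalCoefficientSolver commutativeSemiring using (solve; _:+_; _:*_; _:=_)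
  open Over rawRing
  open Matrices R
  open SetoidReasoning setoid

  sumN : ℕ → (ℕ → Carrier) → Carrier
  sumN N f = sumFin {N} (λ i → f (toℕ i))

  sumN-cong : ∀ N {f g : ℕ → Carrier} → (∀ m → f m ≈ g m) → sumN N f ≈ sumN N g
  sumN-cong N e = sum-cong {N} (λ i → e (toℕ i))

  sumN-+ : ∀ N (f g : ℕ → Carrier) → sumN N (λ m → f m + g m) ≈ sumN N f + sumN N g
  sumN-+ N f g = sum-+ {N} (λ i → f (toℕ i)) (λ i → g (toℕ i))

  sumN-last : ∀ N (f : ℕ → Carrier) → sumN (suc N) f ≈ sumN N f + f N
  sumN-last zero    f = +-comm _ _
  sumN-last (suc N) f = trans (+-congˡ (sumN-last N (λ k → f (suc k)))) (sym (+-assoc _ _ _))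

  stirling : ℕ → ℕ → Carrier
  stirling zero    zero    = 1#
  stirling zero    (suc m) = 0#
  stirling (suc k) zero    = λ′ 0 * stirling k 0
  stirling (suc k) (suc m) = stirling k m + λ′ (suc m) * stirling k (suc m)

  stirling-above : ∀ k m → k < m → stirling k m ≈ 0#
  stirling-above zero    (suc m) _         = refl
  stirling-above (suc k) (suc m) (s≤s k<m) =
    trans (+-cong (stirling-above k m k<m)
                  (trans (*-congˡ (stirling-above k (suc m) (ℕ.m<n⇒m<1+n k<m))) (zeroʳ _)))
          (+-identityˡ 0#)

  stirling-diagonal : ∀ k → stirling k k ≈ 1#
  stirling-diagonal zero    = refl
  stirling-diagonal (suc k) =
    trans (+-cong (stirling-diagonal k) (trans (*-congˡ (stirling-above k (suc k) ℕ.≤-refl)) (zeroʳ _)))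
          (+-identityʳ 1#)

  stirling-lower : ∀ {n} → LowerUnitriangular {n} (λ i j → stirling (toℕ i) (toℕ j))
  stirling-lower = record { above-zero   = λ i j → stirling-above (toℕ i) (toℕ j)
                          ; diagonal-one = λ i → stirling-diagonal (toℕ i) }

  module _ (t : Carrier) (u : ℕ → Carrier) (u₀≈1 : u 0 ≈ 1#)
           (recurrence : ∀ m → t * u m ≈ u (suc m) + λ′ m * u m) where

    -- multiplying an expansion by t shifts it along the Stirling recurrence,
    -- provided the coefficient of the last basis element vanishes
    expansion-step : ∀ k N → k < N →
      sumN (suc N) (λ m → stirling k m * u m) * t ≈ sumN (suc N) (λ m → stirling (suc k) m * u m)
    expansion-step k N k<N = begin
      sumN (suc N) (λ m → S m * u m) * t
        ≈⟨ *-sumʳ {suc N} t (λ i → S (toℕ i) * u (toℕ i)) ⟩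
      sumN (suc N) (λ m → (S m * u m) * t)
        ≈⟨ sumN-cong (suc N) split ⟩
      sumN (suc N) (λ m → S m * u (suc m) + (λ′ m * S m) * u m)
        ≈⟨ sumN-+ (suc N) (λ m → S m * u (suc m)) (λ m → (λ′ m * S m) * u m) ⟩
      sumN (suc N) (λ m → S m * u (suc m)) + sumN (suc N) (λ m → (λ′ m * S m) * u m)
        ≈⟨ +-congʳ (trans (sumN-last N (λ m → S m * u (suc m))) top-vanishes) ⟩
      sumN N (λ m → S m * u (suc m)) + ((λ′ 0 * S 0) * u 0 + sumN N (λ m → (λ′ (suc m) * S (suc m)) * u (suc m)))
        ≈⟨ x∙yz≈y∙xz _ _ _ ⟩
      (λ′ 0 * S 0) * u 0 + (sumN N (λ m → S m * u (suc m)) + sumN N (λ m → (λ′ (suc m) * S (suc m)) * u (suc m)))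
        ≈⟨ +-congˡ (sym (sumN-+ N (λ m → S m * u (suc m)) (λ m → (λ′ (suc m) * S (suc m)) * u (suc m)))) ⟩
      (λ′ 0 * S 0) * u 0 + sumN N (λ m → S m * u (suc m) + (λ′ (suc m) * S (suc m)) * u (suc m))
        ≈⟨ +-congˡ (sumN-cong N (λ m → sym (distribʳ (u (suc m)) (S m) (λ′ (suc m) * S (suc m))))) ⟩
      sumN (suc N) (λ m → stirling (suc k) m * u m) ∎
      where
      S : ℕ → Carrier
      S = stirling k
      split : ∀ m → (S m * u m) * t ≈ S m * u (suc m) + (λ′ m * S m) * u m
      split m = begin
        (S m * u m) * t              ≈⟨ trans (*-assoc _ _ _) (*-congˡ (*-comm _ t)) ⟩
        S m * (t * u m)              ≈⟨ *-congˡ (recurrence m) ⟩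
        S m * (u (suc m) + λ′ m * u m)
          ≈⟨ solve 4 (λ s u′ l u → s :* (u′ :+ l :* u) := s :* u′ :+ (l :* s) :* u) refl (S m) (u (suc m)) (λ′ m) (u m) ⟩
        S m * u (suc m) + (λ′ m * S m) * u m ∎
      top-vanishes : sumN N (λ m → S m * u (suc m)) + S N * u (suc N) ≈ sumN N (λ m → S m * u (suc m))
      top-vanishes = trans (+-congˡ (trans (*-congʳ (stirling-above k N k<N)) (zeroˡ _))) (+-identityʳ _)

    expansion : ∀ k N → k < N → pow t k ≈ sumN N (λ m → stirling k m * u m)
    expansion zero    (suc N) _ =
      sym (trans (+-cong (trans (*-identityˡ _) u₀≈1) (sum-zero {N} (λ i → zeroˡ (u (suc (toℕ i))))))
                 (+-identityʳ 1#))
    expansion (suc k) (suc N) (s≤s k<N) = begin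
      pow t k * t                                        ≈⟨ *-congʳ (expansion k (suc N) (ℕ.m<n⇒m<1+n k<N)) ⟩
      sumN (suc N) (λ m → stirling k m * u m) * t       ≈⟨ expansion-step k N k<N ⟩
      sumN (suc N) (λ m → stirling (suc k) m * u m)     ∎

module QCalculus (R : CommutativeRing 0ℓ 0ℓ) (q : CommutativeRing.Carrier R) where
  open CommutativeRing R hiding (zero)
  open NaturalCoefficientSolver commutativeSemiring using (solve; con; _:+_; _:*_; _:=_)
  open Over rawRing
  open Matrices R
  open SetoidReasoning setoid

  qint-suc : ∀ k → qint q (suc k) ≈ 1# + q * qint q k
  qint-suc k = +-congˡ (trans (sym (*-sumʳ {k} q (λ l → pow q (toℕ l)))) (*-comm _ q))

  qbinom : ℕ → ℕ → Carrier
  qbinom zero    zero    = 1#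
  qbinom zero    (suc m) = 0#
  qbinom (suc j) zero    = 1#
  qbinom (suc j) (suc m) = qbinom j m + pow q (suc m) * qbinom j (suc m)

  qbinom-zero : ∀ j → qbinom j 0 ≈ 1#
  qbinom-zero zero    = refl
  qbinom-zero (suc j) = refl

  qbinom-one : ∀ j → qbinom j 1 ≈ qint q j
  qbinom-one zero    = refl
  qbinom-one (suc j) = begin
    qbinom j 0 + (1# * q) * qbinom j 1 ≈⟨ +-cong (qbinom-zero j) (*-cong (*-identityˡ q) (qbinom-one j)) ⟩
    1# + q * qint q j                  ≈⟨ qint-suc j ⟨
    qint q (suc j)                     ∎

  qbinom-above : ∀ j m → j < m → qbinom j m ≈ 0#
  qbinom-above zero    (suc m) _         = refl
  qbinom-above (suc j) (suc m) (s≤s j<m) =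
    trans (+-cong (qbinom-above j m j<m)
                  (trans (*-congˡ (qbinom-above j (suc m) (ℕ.m<n⇒m<1+n j<m))) (zeroʳ _)))
          (+-identityˡ 0#)

  qbinom-diagonal : ∀ j → qbinom j j ≈ 1#
  qbinom-diagonal zero    = refl
  qbinom-diagonal (suc j) =
    trans (+-cong (qbinom-diagonal j) (trans (*-congˡ (qbinom-above j (suc j) ℕ.≤-refl)) (zeroʳ _)))
          (+-identityʳ 1#)

  qbinom-upper : ∀ {n} → UpperUnitriangular {n} (λ m j → qbinom (toℕ j) (toℕ m))
  qbinom-upper = record { above-zero   = λ j m → qbinom-above (toℕ j) (toℕ m)
                        ; diagonal-one = λ j → qbinom-diagonal (toℕ j) }

  -- The inductive step of the absorption identity below, as a ring identity:
  -- J′ = [j+1], J = [j], K = [m], K₁ = [m+1], K₂ = [m+2], Q = qᵐ and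
  -- b₀, b₁, b₂ = [j choose m], [j choose m+1], [j choose m+2].
  absorption-step : ∀ {J J′ K K₁ K₂ Q b₀ b₁ b₂} →
    J′ ≈ 1# + q * J → K₁ ≈ 1# + q * K → K₂ ≈ 1# + q * K₁ →
    J * b₀ ≈ (Q * K₁) * b₁ + K * b₀ →
    J * b₁ ≈ ((Q * q) * K₂) * b₂ + K₁ * b₁ →
    J′ * (b₀ + (Q * q) * b₁) ≈ ((Q * q) * K₂) * (b₁ + ((Q * q) * q) * b₂) + K₁ * (b₀ + (Q * q) * b₁)
  absorption-step {J} {J′} {K} {K₁} {K₂} {Q} {b₀} {b₁} {b₂} eJ′ eK₁ eK₂ hyp₀ hyp₁ = begin
    J′ * (b₀ + (Q * q) * b₁)
      ≈⟨ *-congʳ eJ′ ⟩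
    (1# + q * J) * (b₀ + (Q * q) * b₁)
      ≈⟨ solve 5 (λ q J Q b₀ b₁ → (con 1 :+ q :* J) :* (b₀ :+ (Q :* q) :* b₁)
                                := ((b₀ :+ (Q :* q) :* b₁) :+ q :* (J :* b₀)) :+ ((Q :* q) :* q) :* (J :* b₁))
               refl q J Q b₀ b₁ ⟩
    ((b₀ + (Q * q) * b₁) + q * (J * b₀)) + ((Q * q) * q) * (J * b₁)
      ≈⟨ +-cong (+-congˡ (*-congˡ hyp₀)) (*-congˡ hyp₁) ⟩
    ((b₀ + (Q * q) * b₁) + q * ((Q * K₁) * b₁ + K * b₀)) + ((Q * q) * q) * (((Q * q) * K₂) * b₂ + K₁ * b₁)
      ≈⟨ solve 8 (λ q K K₁ K₂ Q b₀ b₁ b₂ →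
              ((b₀ :+ (Q :* q) :* b₁) :+ q :* ((Q :* K₁) :* b₁ :+ K :* b₀))
                :+ ((Q :* q) :* q) :* (((Q :* q) :* K₂) :* b₂ :+ K₁ :* b₁)
              := ((((Q :* q) :* (con 1 :+ q :* K₁)) :* b₁ :+ ((Q :* q) :* K₂) :* (((Q :* q) :* q) :* b₂))
                   :+ (con 1 :+ q :* K) :* b₀) :+ K₁ :* ((Q :* q) :* b₁))
               refl q K K₁ K₂ Q b₀ b₁ b₂ ⟩
    ((((Q * q) * (1# + q * K₁)) * b₁ + ((Q * q) * K₂) * (((Q * q) * q) * b₂)) + (1# + q * K) * b₀)
      + K₁ * ((Q * q) * b₁)
      ≈⟨ +-congʳ (+-cong (+-congʳ (*-congʳ (*-congˡ (sym eK₂)))) (*-congʳ (sym eK₁))) ⟩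
    ((((Q * q) * K₂) * b₁ + ((Q * q) * K₂) * (((Q * q) * q) * b₂)) + K₁ * b₀) + K₁ * ((Q * q) * b₁)
      ≈⟨ solve 8 (λ q K₁ K₂ Q b₀ b₁ b₂ Qq →
              (((Qq :* K₂) :* b₁ :+ (Qq :* K₂) :* ((Qq :* q) :* b₂)) :+ K₁ :* b₀) :+ K₁ :* (Qq :* b₁)
              := (Qq :* K₂) :* (b₁ :+ (Qq :* q) :* b₂) :+ K₁ :* (b₀ :+ Qq :* b₁))
               refl q K₁ K₂ Q b₀ b₁ b₂ (Q * q) ⟩
    ((Q * q) * K₂) * (b₁ + ((Q * q) * q) * b₂) + K₁ * (b₀ + (Q * q) * b₁) ∎

  -- [j] [j choose m] = qᵐ [m+1] [j choose m+1] + [m] [j choose m], i.e.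
  -- ([j] − [m]) [j choose m] = qᵐ [m+1] [j choose m+1]
  absorption : ∀ j m → qint q j * qbinom j m ≈ (pow q m * qint q (suc m)) * qbinom j (suc m) + qint q m * qbinom j m
  absorption zero    zero    = trans (zeroˡ 1#) (sym (trans (+-cong (zeroʳ _) (zeroˡ 1#)) (+-identityˡ 0#)))
  absorption zero    (suc m) = trans (zeroˡ 0#) (sym (trans (+-cong (zeroʳ _) (zeroʳ _)) (+-identityˡ 0#)))
  absorption (suc j) zero    = begin
    qint q (suc j) * 1#                                    ≈⟨ *-identityʳ _ ⟩
    qint q (suc j)                                         ≈⟨ qbinom-one (suc j) ⟨
    qbinom (suc j) 1                                       ≈⟨ *-identityˡ _ ⟨
    1# * qbinom (suc j) 1                                  ≈⟨ *-congʳ (trans (*-identityˡ _) (+-identityʳ 1#)) ⟨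
    (1# * qint q 1) * qbinom (suc j) 1                     ≈⟨ +-identityʳ _ ⟨
    (1# * qint q 1) * qbinom (suc j) 1 + 0#                ≈⟨ +-congˡ (zeroˡ 1#) ⟨
    (pow q 0 * qint q 1) * qbinom (suc j) 1 + qint q 0 * 1# ∎
  absorption (suc j) (suc m) =
    absorption-step (qint-suc j) (qint-suc m) (qint-suc (suc m)) (absorption j m) (absorption j (suc m))

module DiagonalForms (R : CommutativeRing 0ℓ 0ℓ) (a q : CommutativeRing.Carrier R) where
  open CommutativeRing R hiding (zero)
  open NaturalCoefficientSolver commutativeSemiring using (solve; con; _:+_; _:*_; _:=_)
  open Over rawRing
  open Matrices R
  open QCalculus R q
  open SetoidReasoning setoid

  pow-cong : ∀ {x y} k → x ≈ y → pow x k ≈ pow y k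
  pow-cong zero    e = refl
  pow-cong (suc k) e = *-cong (pow-cong k e) e

  pow-+ : ∀ x k l → pow x (k +ℕ l) ≈ pow x k * pow x l
  pow-+ x zero    l = sym (*-identityˡ _)
  pow-+ x (suc k) l = begin
    pow x (k +ℕ l) * x      ≈⟨ *-congʳ (pow-+ x k l) ⟩
    (pow x k * pow x l) * x ≈⟨ solve 3 (λ A B X → (A :* B) :* X := (A :* X) :* B) refl (pow x k) (pow x l) x ⟩
    (pow x k * x) * pow x l ∎

  pow-* : ∀ x y k → pow x k * pow y k ≈ pow (x * y) k
  pow-* x y zero    = *-identityʳ 1#
  pow-* x y (suc k) = begin
    (pow x k * x) * (pow y k * y) ≈⟨ solve 4 (λ X x′ Y y′ → (X :* x′) :* (Y :* y′) := (X :* Y) :* (x′ :* y′)) refl (pow x k) x (pow y k) y ⟩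
    (pow x k * pow y k) * (x * y) ≈⟨ *-congʳ (pow-* x y k) ⟩
    pow (x * y) k * (x * y)       ∎

  diagonalEntry : ℕ → Carrier
  diagonalEntry m = (pow a m * pow q (m C 2)) * qfact q m

  -- consecutive entries differ by the factor a qᵐ [m+1]
  ratio : ℕ → Carrier
  ratio m = a * (pow q m * qint q (suc m))

  suc-C-2 : ∀ m → suc m C 2 ≡ m +ℕ m C 2
  suc-C-2 m = ≡.trans (≡.sym (nCk+nC[k+1]≡[n+1]C[k+1] m 1)) (≡.cong (_+ℕ m C 2) (nC1≡n m))

  pow-q-suc-C-2 : ∀ m → pow q (suc m C 2) ≈ pow q m * pow q (m C 2)
  pow-q-suc-C-2 m = trans (reflexive (≡.cong (pow q) (suc-C-2 m))) (pow-+ q m (m C 2))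

  diagonalEntry-suc : ∀ m → diagonalEntry (suc m) ≈ diagonalEntry m * ratio m
  diagonalEntry-suc m = begin
    ((pow a m * a) * pow q (suc m C 2)) * (qfact q m * qint q (suc m))
      ≈⟨ *-congʳ (*-congˡ (pow-q-suc-C-2 m)) ⟩
    ((pow a m * a) * (pow q m * pow q (m C 2))) * (qfact q m * qint q (suc m))
      ≈⟨ solve 6 (λ A a′ Qm Qc F K → ((A :* a′) :* (Qm :* Qc)) :* (F :* K) := ((A :* Qc) :* F) :* (a′ :* (Qm :* K)))
               refl (pow a m) a (pow q m) (pow q (m C 2)) (qfact q m) (qint q (suc m)) ⟩
    diagonalEntry m * ratio m ∎

  diagonalEntry-at-q : a ≈ q → ∀ m → pow q (suc m C 2) * qfact q m ≈ diagonalEntry m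
  diagonalEntry-at-q a≈q m = *-congʳ (trans (pow-q-suc-C-2 m) (*-congʳ (pow-cong m (sym a≈q))))

  diagonalEntry-multiple : ∀ {m n} → m ≤′ n → MultipleOf (diagonalEntry n) (diagonalEntry m)
  diagonalEntry-multiple ≤′-refl = 1# , sym (*-identityˡ _)
  diagonalEntry-multiple {m} (≤′-step {n} m≤′n) with diagonalEntry-multiple m≤′n
  ... | c , e = c * ratio n , (begin
    diagonalEntry (suc n)            ≈⟨ diagonalEntry-suc n ⟩
    diagonalEntry n * ratio n        ≈⟨ *-congʳ e ⟩
    (c * diagonalEntry m) * ratio n  ≈⟨ solve 3 (λ c D r → (c :* D) :* r := (c :* r) :* D) refl c (diagonalEntry m) (ratio n) ⟩
    (c * ratio n) * diagonalEntry m  ∎)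

  diagonalEntry-chain : ∀ {n} (d : Fin n → Carrier) → (∀ i → d i ≈ diagonalEntry (toℕ i)) →
                        DivisibilityChain d
  diagonalEntry-chain d e i j j≤i =
    MultipleOf-resp (e i) (e j) (diagonalEntry-multiple (ℕ.≤⇒≤′ j≤i))

  -- basis j m = aᵐ q^(m choose 2) [m]!_q [j choose m]_q is the value at x = [j]_q of
  -- aᵐ x (x − [1]_q) ⋯ (x − [m−1]_q); the absorption identity makes multiplication
  -- by a x a three-term recurrence in m.
  basis : ℕ → ℕ → Carrier
  basis j m = diagonalEntry m * qbinom j m

  basis-zero : ∀ j → basis j 0 ≈ 1#
  basis-zero j = trans (*-cong (trans (*-identityʳ _) (*-identityˡ _)) (qbinom-zero j)) (*-identityʳ 1#)

  basis-recurrence : ∀ j m → (a * qint q j) * basis j m ≈ basis j (suc m) + (a * qint q m) * basis j m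
  basis-recurrence j m = begin
    (a * qint q j) * (diagonalEntry m * qbinom j m)
      ≈⟨ solve 4 (λ a′ J D b → (a′ :* J) :* (D :* b) := (a′ :* D) :* (J :* b)) refl a (qint q j) (diagonalEntry m) (qbinom j m) ⟩
    (a * diagonalEntry m) * (qint q j * qbinom j m)
      ≈⟨ *-congˡ (absorption j m) ⟩
    (a * diagonalEntry m) * ((pow q m * qint q (suc m)) * qbinom j (suc m) + qint q m * qbinom j m)
      ≈⟨ solve 7 (λ a′ D Q K₁ K b₁ b₀ → (a′ :* D) :* ((Q :* K₁) :* b₁ :+ K :* b₀)
                                      := (D :* (a′ :* (Q :* K₁))) :* b₁ :+ (a′ :* K) :* (D :* b₀))
               refl a (diagonalEntry m) (pow q m) (qint q (suc m)) (qint q m) (qbinom j (suc m)) (qbinom j m) ⟩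
    (diagonalEntry m * ratio m) * qbinom j (suc m) + (a * qint q m) * basis j m
      ≈⟨ +-congʳ (*-congʳ (diagonalEntry-suc m)) ⟨
    basis j (suc m) + (a * qint q m) * basis j m ∎

  shifted-recurrence : ∀ j m → (1# + a * qint q j) * basis j m ≈ basis j (suc m) + (1# + a * qint q m) * basis j m
  shifted-recurrence j m = begin
    (1# + a * qint q j) * basis j m                        ≈⟨ distribʳ _ _ _ ⟩
    1# * basis j m + (a * qint q j) * basis j m            ≈⟨ +-congˡ (basis-recurrence j m) ⟩
    1# * basis j m + (basis j (suc m) + (a * qint q m) * basis j m)
      ≈⟨ solve 4 (λ u u′ a′ K → con 1 :* u :+ (u′ :+ (a′ :* K) :* u) := u′ :+ (con 1 :+ a′ :* K) :* u)
               refl (basis j m) (basis j (suc m)) a (qint q m) ⟩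
    basis j (suc m) + (1# + a * qint q m) * basis j m      ∎

  qbinomMatrix : ∀ {n} → Matrix n n
  qbinomMatrix m j = qbinom (toℕ j) (toℕ m)

  module _ (λ′ : ℕ → Carrier) where
    open PowerExpansion R λ′ using (stirling; stirling-lower; expansion)

    stirlingMatrix : ∀ {n} → Matrix n n
    stirlingMatrix i k = stirling (toℕ i) (toℕ k)

    stirlingMatrix-lower : ∀ {n} → LowerUnitriangular (stirlingMatrix {n})
    stirlingMatrix-lower = stirling-lower

    power-factorisation : ∀ {n} (t d : Fin n → Carrier) →
      (∀ j m → t j * basis (toℕ j) m ≈ basis (toℕ j) (suc m) + λ′ m * basis (toℕ j) m) →
      (∀ i → d i ≈ diagonalEntry (toℕ i)) →
      (λ i j → pow (t j) (toℕ i)) ≈ₘ stirlingMatrix ⊗ (diagMat d ⊗ qbinomMatrix)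
    power-factorisation {n} t d recurrence e = entrywise λ i j → begin
      pow (t j) (toℕ i)
        ≈⟨ expansion (t j) (basis (toℕ j)) (basis-zero (toℕ j)) (recurrence j) (toℕ i) n (toℕ<n i) ⟩
      sumFin {n} (λ k → stirling (toℕ i) (toℕ k) * basis (toℕ j) (toℕ k))
        ≈⟨ sum-cong {n} (λ k → *-congˡ (sym (trans (entry (diagMat-⊗ d qbinomMatrix) k j) (*-congʳ (e k))))) ⟩
      sumFin {n} (λ k → stirling (toℕ i) (toℕ k) * (diagMat d ⊗ qbinomMatrix) k j) ∎

  ssnf-of-powers : ∀ n (t d : Fin n → Carrier) → (∀ j → t j ≈ 1# + a * qint q (toℕ j)) →
                   (∀ i → d i ≈ diagonalEntry (toℕ i)) →
                   IsSSNF (λ i j → pow (t j) (toℕ i)) (diagMat d)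
  ssnf-of-powers n t d et ed =
    ssnf-of-LDU n _ (stirlingMatrix λ′) qbinomMatrix d (stirlingMatrix-lower λ′) qbinom-upper
      (power-factorisation λ′ t d recurrence ed) (diagonalEntry-chain d ed)
    where
    λ′ : ℕ → Carrier
    λ′ m = 1# + a * qint q m
    recurrence : ∀ j m → t j * basis (toℕ j) m ≈ basis (toℕ j) (suc m) + λ′ m * basis (toℕ j) m
    recurrence j m = trans (*-congʳ (et j)) (shifted-recurrence (toℕ j) m)

  ssnf-of-polynomials : ∀ n (A : (i : Fin n) → Fin (suc (toℕ i)) → Carrier) →
    (∀ i → A i (fromℕ (toℕ i)) ≈ 1#) →
    IsSSNF (λ i j → sumFin (λ k → A i k * (pow a (toℕ k) * pow (qint q (toℕ j)) (toℕ k))))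
           (diagMat (λ i → diagonalEntry (toℕ i)))
  ssnf-of-polynomials n A monic =
    ssnf-of-LDU n M (coefficients ⊗ S) qbinomMatrix d (⊗-lower coefficients-lower (stirlingMatrix-lower λ′)) qbinom-upper
      M≈LDU (diagonalEntry-chain d (λ _ → refl))
    where
    λ′ : ℕ → Carrier
    λ′ m = a * qint q m
    M : Matrix n n
    M i j = sumFin (λ k → A i k * (pow a (toℕ k) * pow (qint q (toℕ j)) (toℕ k)))
    d : Fin n → Carrier
    d i = diagonalEntry (toℕ i)
    S D B P : Matrix n n
    S = stirlingMatrix λ′
    D = diagMat d
    B = qbinomMatrix
    P k j = pow (a * qint q (toℕ j)) (toℕ k)

    coefficients : Matrix n n
    coefficients i k = extend (A i) (toℕ k)

    coefficients-lower : LowerUnitriangular coefficients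
    coefficients-lower = record
      { above-zero   = λ i k → extend-beyond (A i) (toℕ k)
      ; diagonal-one = λ i → trans (reflexive (≡.trans (≡.cong (extend (A i)) (≡.sym (toℕ-fromℕ (toℕ i))))
                                                       (extend-toℕ (A i) (fromℕ (toℕ i)))))
                                   (monic i) }

    M≈AP : M ≈ₘ coefficients ⊗ P
    M≈AP = entrywise λ i j →
      trans (sum-cong {suc (toℕ i)} (λ k → *-congˡ {A i k} (pow-* a (qint q (toℕ j)) (toℕ k))))
            (sum-extend (A i) (λ k → pow (a * qint q (toℕ j)) k) (toℕ<n i))

    M≈LDU : M ≈ₘ (coefficients ⊗ S) ⊗ (D ⊗ B)
    M≈LDU =
      M                              ≈ₘ⟨ M≈AP ⟩
      coefficients ⊗ P               ≈ₘ⟨ ⊗-congʳ coefficients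
                                           (power-factorisation λ′ (λ j → a * qint q (toℕ j)) d
                                              (λ j → basis-recurrence (toℕ j)) (λ _ → refl)) ⟩
      coefficients ⊗ (S ⊗ (D ⊗ B))   ≈ₘ⟨ ≈ₘ-sym (⊗-assoc coefficients S (D ⊗ B)) ⟩
      (coefficients ⊗ S) ⊗ (D ⊗ B)   ∎ₘ

ℤ[q] : CommutativeRing 0ℓ 0ℓ
ℤ[q] = CoefficientListRing.polynomialRing +-*-commutativeRing

ℤ[a,q] : CommutativeRing 0ℓ 0ℓ
ℤ[a,q] = CoefficientListRing.polynomialRing ℤ[q]

module Over-ℤ[a,q] = DiagonalForms ℤ[a,q] aZaq qZaq
module Over-ℤ[q]   = DiagonalForms ℤ[q] qZq qZq

theorem7p1 :
    (∀ (n : ℕ) (A : (i : Fin (suc n)) → Fin (suc (toℕ i)) → List (List ℤ)) →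
       (∀ i → RawRing._≈_ ZaqR (A i (fromℕ (toℕ i))) (RawRing.1# ZaqR)) →
       Zaq.IsSSNF {suc n} {suc n}
         (λ i j → gPoly A i (Zaq.qint qZaq (toℕ j)))
         (Zaq.diagMat (λ i → dZaq (toℕ i))))
    × (∀ (n : ℕ) →
       Zaq.IsSSNF {suc n} {suc n}
         (λ i j → Zaq.pow (RawRing._+_ ZaqR (RawRing.1# ZaqR)
                    (RawRing._*_ ZaqR aZaq (Zaq.qint qZaq (toℕ j)))) (toℕ i))
         (Zaq.diagMat (λ i → dZaq (toℕ i))))
    × (∀ (n : ℕ) →
       Zq.IsSSNF {suc n} {suc n}
         (λ i j → Zq.pow (Zq.qint qZq (suc (toℕ j))) (toℕ i))
         (Zq.diagMat (λ i → dZq (toℕ i))))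
theorem7p1 =
  (λ n A monic → Over-ℤ[a,q].ssnf-of-polynomials (suc n) A monic) ,
  (λ n → Over-ℤ[a,q].ssnf-of-powers (suc n) (λ j → 1+a[ j ]) (λ i → dZaq (toℕ i))
           (λ j → CommutativeRing.refl ℤ[a,q] {1+a[ j ]})
           (λ i → CommutativeRing.refl ℤ[a,q] {dZaq (toℕ i)})) ,
  -- part (b) is part (a) over ℤ[q] with a = q, as [j+1]_q = 1 + q [j]_q
  (λ n → Over-ℤ[q].ssnf-of-powers (suc n) (λ j → Zq.qint qZq (suc (toℕ j))) (λ i → dZq (toℕ i))
           (λ j → QCalculus.qint-suc ℤ[q] qZq (toℕ j))
           (λ i → Over-ℤ[q].diagonalEntry-at-q (CommutativeRing.refl ℤ[q] {qZq}) (toℕ i)))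
  where
  1+a[_] : ∀ {n} → Fin n → List (List ℤ)
  1+a[ j ] = RawRing._+_ ZaqR (RawRing.1# ZaqR) (RawRing._*_ ZaqR aZaq (Zaq.qint qZaq (toℕ j)))
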